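{- Let $q\ge 3$ and let $b,c$ be distinct residues modulo $q$ with $(b,q)=(c,q)=1$. Suppose that $r$ is a positive integer with $r\mid\operatorname{ord}_q b$ and that for every prime power $p^a\,\|\, r$ with $a\ge1$ we have $p^{a+1}\nmid\operatorname{ord}_q c$. Then there is a Dirichlet character $\chi$ modulo $q$ such that $\chi(b)=e(1/r)$ and $\chi(c)^r=1$.
   Context: $e(z)=e^{2\pi i z}$; $\operatorname{ord}_q(b)$ is the multiplicative order of $b$ modulo $q$; $p^a\,\|\,r$ means $p^a\mid r$ and $p^{a+1}\nmid r$. -}

module Defs where

open import Data.Nat using (ℕ; zero; suc; _^_; _≤_; NonZero)
open import Data.Nat.DivMod using (_%_)
open import Data.Nat.Coprimality using (Coprime)
open import Data.Integer using (ℤ; +_)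
open import Data.Rational using (ℚ; _/_; _+_; _-_)
open import Data.Product using (Σ; _×_)
open import Relation.Binary.PropositionalEquality using (_≡_)

_≡₁_ : ℚ → ℚ → Set
x ≡₁ y = Σ ℤ (λ k → x - y ≡ k / 1)

infix 4 _≡₁_

ModEq : (q : ℕ) → .{{NonZero q}} → ℕ → ℕ → Set
ModEq q a b = a % q ≡ b % q

IsOrd : (q : ℕ) → .{{NonZero q}} → ℕ → ℕ → Set
IsOrd q b k =
  (1 ≤ k) × (ModEq q (b ^ k) 1) ×
  ((j : ℕ) → 1 ≤ j → ModEq q (b ^ j) 1 → k ≤ j)

-- A Dirichlet character modulo q, recorded through its "angle":
-- χ(n) = e(θ n) for n coprime to q (and χ(n) = 0 otherwise, not recorded).
-- θ is well defined on residues mod q and additive (mod 1) on units,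
-- i.e. χ is a homomorphism (ℤ/qℤ)^× → ℂ^× (whose values are roots of unity).
record DirChar (q : ℕ) .{{_ : NonZero q}} : Set where
  field
    θ     : ℕ → ℚ
    θ-mod : (m n : ℕ) → Coprime m q → ModEq q m n → θ m ≡₁ θ n
    θ-mul : (m n : ℕ) → Coprime m q → Coprime n q →
            θ (m Data.Nat.* n) ≡₁ θ m + θ n

module Submission where

-- A character of (ℤ/qℤ)^× is built one generator at a time: b, then c, then every unit
-- residue.  Angles t_i for generators g_i are consistent when every relation ∏ g_i^{k_i} ≡ 1
-- (mod q) gives Σ k_i t_i ∈ ℤ, and a consistent assignment extends to a new generator g_n by
-- any τ with m τ ≡ Σ k_i t_i (mod 1), where m is the least exponent with
-- g_n^m = ∏_{i<n} g_i^{k_i}.  For b we take τ = 1/r, allowed because r ∣ ord b.  For c, with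
-- c^m ≡ b^K, we need m τ ≡ K/r and r τ ≡ 0 (mod 1), which is solvable when gcd(m, r) ∣ K.
-- Since b^{K ord(c)/m} ≡ c^{ord c} ≡ 1 we get r m ∣ K ord(c), and the hypothesis that ord(c)
-- has no larger p-part than r at the primes p ∣ r turns this into gcd(m, r) ∣ K.

open import Data.Nat using (ℕ; NonZero)
open import Data.Nat.Coprimality using (Coprime)
open import Data.Nat.Divisibility using (_∣_)
open import Defs

module IntegerRationals where

  open import Data.Nat as ℕ using (ℕ; suc)
  open import Data.Nat.Coprimality as Coprimality using (1-coprimeTo)
  open import Data.Nat.GCD using (gcd; gcd-GCD; module Bézout)
  open import Data.Nat.Divisibility using (_∣_; divides)
  open import Data.Integer as ℤ using (ℤ; +_)
  import Data.Integer.Properties as ℤ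
  open import Data.Rational
  open import Data.Rational.Properties using (↥p/↧p≡p; normalize-coprime; *-inverseʳ)
  open import Data.Rational.Solver using (module +-*-Solver)
  open import Data.Product using (Σ; _×_; _,_)
  open import Relation.Binary.PropositionalEquality
  open +-*-Solver

  fromℤ : ℤ → ℚ
  fromℤ z = z / 1

  fromℕ : ℕ → ℚ
  fromℕ n = fromℤ (+ n)

  IsInteger : ℚ → Set
  IsInteger x = Σ ℤ λ z → x ≡ fromℤ z

  fromℤ≡mkℚ : ∀ z → fromℤ z ≡ mkℚ z 0 (Coprimality.sym (1-coprimeTo ℤ.∣ z ∣))
  fromℤ≡mkℚ z = ↥p/↧p≡p (mkℚ z 0 (Coprimality.sym (1-coprimeTo ℤ.∣ z ∣)))

  fromℤ-+ : ∀ a b → fromℤ (a ℤ.+ b) ≡ fromℤ a + fromℤ b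
  fromℤ-+ a b rewrite fromℤ≡mkℚ a | fromℤ≡mkℚ b =
    sym (cong₂ (λ x y → (x ℤ.+ y) / 1) (ℤ.*-identityʳ a) (ℤ.*-identityʳ b))

  fromℤ-* : ∀ a b → fromℤ (a ℤ.* b) ≡ fromℤ a * fromℤ b
  fromℤ-* a b rewrite fromℤ≡mkℚ a | fromℤ≡mkℚ b = refl

  fromℤ-neg : ∀ a → fromℤ (ℤ.- a) ≡ - fromℤ a
  fromℤ-neg a = begin
    fromℤ (ℤ.- a)                       ≡⟨ solve 2 (λ x y → y := :- x :+ (x :+ y)) refl (fromℤ a) (fromℤ (ℤ.- a)) ⟩
    - fromℤ a + (fromℤ a + fromℤ (ℤ.- a)) ≡⟨ cong (λ w → - fromℤ a + w) (sym (fromℤ-+ a (ℤ.- a))) ⟩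
    - fromℤ a + fromℤ (a ℤ.+ ℤ.- a)      ≡⟨ cong (λ z → - fromℤ a + fromℤ z) (ℤ.+-inverseʳ a) ⟩
    - fromℤ a + 0ℚ                       ≡⟨ solve 1 (λ x → x :+ con 0ℚ := x) refl (- fromℤ a) ⟩
    - fromℤ a                            ∎
    where open ≡-Reasoning

  fromℕ-+ : ∀ m n → fromℕ (m ℕ.+ n) ≡ fromℕ m + fromℕ n
  fromℕ-+ m n = trans (cong fromℤ (ℤ.pos-+ m n)) (fromℤ-+ (+ m) (+ n))

  fromℕ-* : ∀ m n → fromℕ (m ℕ.* n) ≡ fromℕ m * fromℕ n
  fromℕ-* m n = trans (cong fromℤ (ℤ.pos-* m n)) (fromℤ-* (+ m) (+ n))

  fromℕ*1/n≡1 : ∀ n .{{_ : ℕ.NonZero n}} → fromℕ n * (+ 1 / n) ≡ 1ℚ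
  fromℕ*1/n≡1 (suc n) = begin
    fromℕ (suc n) * (+ 1 / suc n) ≡⟨ cong₂ _*_ (fromℤ≡mkℚ (+ suc n)) (normalize-coprime (1-coprimeTo (suc n))) ⟩
    p * 1/p                        ≡⟨ *-inverseʳ p ⟩
    1ℚ                             ∎
    where
    open ≡-Reasoning
    p = mkℚ (+ suc n) 0 (Coprimality.sym (1-coprimeTo (suc n)))
    1/p = mkℚ (+ 1) n (1-coprimeTo (suc n))

  fromℕ-+-* : ∀ a b c → fromℕ (a ℕ.+ b ℕ.* c) ≡ fromℕ a + fromℕ b * fromℕ c
  fromℕ-+-* a b c = trans (fromℕ-+ a (b ℕ.* c)) (cong (λ w → fromℕ a + w) (fromℕ-* b c))

  bézout : ∀ m n → Σ ℤ λ x → Σ ℤ λ y → fromℤ x * fromℕ m ≡ fromℕ (gcd m n) + fromℤ y * fromℕ n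
  bézout m n with Bézout.identity (gcd-GCD m n)
  ... | Bézout.+- x y eq = + x , + y , (begin
    fromℕ x * fromℕ m         ≡⟨ sym (fromℕ-* x m) ⟩
    fromℕ (x ℕ.* m)           ≡⟨ cong fromℕ eq ⟨
    fromℕ (d ℕ.+ y ℕ.* n)     ≡⟨ fromℕ-+-* d y n ⟩
    fromℕ d + fromℕ y * fromℕ n ∎)
    where
    open ≡-Reasoning
    d = gcd m n
  ... | Bézout.-+ x y eq = ℤ.- + x , ℤ.- + y , (begin
    fromℤ (ℤ.- + x) * fromℕ m
      ≡⟨ cong (_* fromℕ m) (fromℤ-neg (+ x)) ⟩
    - fromℕ x * fromℕ m
      ≡⟨ solve 3 (λ D X M → :- X :* M := D :- (D :+ X :* M)) refl (fromℕ d) (fromℕ x) (fromℕ m) ⟩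
    fromℕ d - (fromℕ d + fromℕ x * fromℕ m)
      ≡⟨ cong (λ w → fromℕ d - w) (trans (sym (fromℕ-+-* d x m)) (trans (cong fromℕ eq) (fromℕ-* y n))) ⟩
    fromℕ d - fromℕ y * fromℕ n
      ≡⟨ solve 3 (λ D Y N → D :- Y :* N := D :+ (:- Y) :* N) refl (fromℕ d) (fromℕ y) (fromℕ n) ⟩
    fromℕ d + - fromℕ y * fromℕ n
      ≡⟨ cong (λ w → fromℕ d + w * fromℕ n) (fromℤ-neg (+ y)) ⟨
    fromℕ d + fromℤ (ℤ.- + y) * fromℕ n
      ∎)
    where
    open ≡-Reasoning
    d = gcd m n

  isInteger-fromℤ : ∀ z → IsInteger (fromℤ z)
  isInteger-fromℤ z = z , refl

  isInteger-+ : ∀ {x y} → IsInteger x → IsInteger y → IsInteger (x + y)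
  isInteger-+ (a , refl) (b , refl) = a ℤ.+ b , sym (fromℤ-+ a b)

  isInteger-* : ∀ {x y} → IsInteger x → IsInteger y → IsInteger (x * y)
  isInteger-* (a , refl) (b , refl) = a ℤ.* b , sym (fromℤ-* a b)

  isInteger-neg : ∀ {x} → IsInteger x → IsInteger (- x)
  isInteger-neg (a , refl) = ℤ.- a , sym (fromℤ-neg a)

  isInteger-- : ∀ {x y} → IsInteger x → IsInteger y → IsInteger (x - y)
  isInteger-- i j = isInteger-+ i (isInteger-neg j)

  -- With x m = gcd(m, r) + y r and K = K′ gcd(m, r), the angle τ = x K′ / r works.
  solve-mod-1 : ∀ m r K .{{_ : ℕ.NonZero r}} → gcd m r ∣ K →
                Σ ℚ λ τ → IsInteger (fromℕ m * τ - fromℕ K * (+ 1 / r)) × IsInteger (fromℕ r * τ)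
  solve-mod-1 m r K (divides K′ K≡K′d) with bézout m r
  ... | x , y , xm≡d+yr = τ , (+ K′ ℤ.* y , mτ-K/r) , (x ℤ.* + K′ , rτ)
    where
    open ≡-Reasoning
    d = gcd m r
    R = + 1 / r
    τ = fromℤ x * fromℕ K′ * R
    mτ-K/r : fromℕ m * τ - fromℕ K * R ≡ fromℤ (+ K′ ℤ.* y)
    mτ-K/r = begin
      fromℕ m * τ - fromℕ K * R
        ≡⟨ cong (λ k → fromℕ m * τ - k * R) (trans (cong fromℕ K≡K′d) (fromℕ-* K′ d)) ⟩
      fromℕ m * τ - fromℕ K′ * fromℕ d * R
        ≡⟨ solve 5 (λ m x k d R → m :* (x :* k :* R) :- k :* d :* R := k :* R :* (x :* m :- d))
                   refl (fromℕ m) (fromℤ x) (fromℕ K′) (fromℕ d) R ⟩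
      fromℕ K′ * R * (fromℤ x * fromℕ m - fromℕ d)
        ≡⟨ cong (λ z → fromℕ K′ * R * (z - fromℕ d)) xm≡d+yr ⟩
      fromℕ K′ * R * (fromℕ d + fromℤ y * fromℕ r - fromℕ d)
        ≡⟨ solve 5 (λ k R d y r → k :* R :* (d :+ y :* r :- d) := k :* y :* (r :* R))
                   refl (fromℕ K′) R (fromℕ d) (fromℤ y) (fromℕ r) ⟩
      fromℕ K′ * fromℤ y * (fromℕ r * R)
        ≡⟨ cong (fromℕ K′ * fromℤ y *_) (fromℕ*1/n≡1 r) ⟩
      fromℕ K′ * fromℤ y * 1ℚ
        ≡⟨ solve 2 (λ k y → k :* y :* con 1ℚ := k :* y) refl (fromℕ K′) (fromℤ y) ⟩
      fromℕ K′ * fromℤ y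
        ≡⟨ fromℤ-* (+ K′) y ⟨
      fromℤ (+ K′ ℤ.* y) ∎
    rτ : fromℕ r * τ ≡ fromℤ (x ℤ.* + K′)
    rτ = begin
      fromℕ r * τ
        ≡⟨ solve 4 (λ r x k R → r :* (x :* k :* R) := x :* k :* (r :* R)) refl (fromℕ r) (fromℤ x) (fromℕ K′) R ⟩
      fromℤ x * fromℕ K′ * (fromℕ r * R)
        ≡⟨ cong (fromℤ x * fromℕ K′ *_) (fromℕ*1/n≡1 r) ⟩
      fromℤ x * fromℕ K′ * 1ℚ
        ≡⟨ solve 2 (λ x k → x :* k :* con 1ℚ := x :* k) refl (fromℤ x) (fromℕ K′) ⟩
      fromℤ x * fromℕ K′
        ≡⟨ fromℤ-* x (+ K′) ⟨
      fromℤ (x ℤ.* + K′) ∎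

  ∣⇒isInteger : ∀ {m} r .{{_ : ℕ.NonZero r}} → r ∣ m → IsInteger (fromℕ m * (+ 1 / r))
  ∣⇒isInteger {m} r (divides w m≡wr) = + w , (begin
    fromℕ m * (+ 1 / r)               ≡⟨ cong (λ z → z * (+ 1 / r)) (trans (cong fromℕ m≡wr) (fromℕ-* w r)) ⟩
    fromℕ w * fromℕ r * (+ 1 / r)     ≡⟨ solve 3 (λ w r R → w :* r :* R := w :* (r :* R)) refl (fromℕ w) (fromℕ r) (+ 1 / r) ⟩
    fromℕ w * (fromℕ r * (+ 1 / r))   ≡⟨ cong (fromℕ w *_) (fromℕ*1/n≡1 r) ⟩
    fromℕ w * 1ℚ                      ≡⟨ solve 1 (λ w → w :* con 1ℚ := w) refl (fromℕ w) ⟩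
    fromℕ w                           ∎)
    where open ≡-Reasoning

module Units (q : ℕ) .{{_ : NonZero q}} where

  open import Data.Nat
  open import Data.Nat.Properties
  open import Data.Nat.DivMod
  open import Data.Nat.Divisibility
  open import Data.Nat.Coprimality using (Coprime; coprime-divisor; coprime-Bézout; 1-coprimeTo)
  open import Data.Nat.GCD using (module Bézout)
  open import Data.Nat.Solver using (module +-*-Solver)
  open import Data.Fin using (toℕ; fromℕ<)
  import Data.Fin.Properties as Fin
  open import Data.Product using (Σ; _×_; _,_)
  open import Data.Empty using (⊥-elim)
  open import Relation.Nullary using (Dec)
  open import Relation.Nullary.Decidable using (map′)
  open import Relation.Binary.PropositionalEquality
  open import Relation.Binary.Bundles using (Setoid)
  import Relation.Binary.Reasoning.Setoid as SetoidReasoning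
  open +-*-Solver

  -- A record rather than ModEq q a b, so that a and b can be inferred from a proof of a ≈ b.
  infix 4 _≈_
  record _≈_ (a b : ℕ) : Set where
    constructor mk≈
    field ≈⇒%≡ : a % q ≡ b % q
  open _≈_ public

  ≈-refl : ∀ {a} → a ≈ a
  ≈-refl = mk≈ refl

  ≈-sym : ∀ {a b} → a ≈ b → b ≈ a
  ≈-sym (mk≈ e) = mk≈ (sym e)

  ≈-trans : ∀ {a b c} → a ≈ b → b ≈ c → a ≈ c
  ≈-trans (mk≈ e) (mk≈ f) = mk≈ (trans e f)

  ≈-reflexive : ∀ {a b} → a ≡ b → a ≈ b
  ≈-reflexive refl = ≈-refl

  ≈-setoid : Setoid _ _
  ≈-setoid = record
    { Carrier = ℕ ; _≈_ = _≈_ ; isEquivalence = record { refl = ≈-refl ; sym = ≈-sym ; trans = ≈-trans } }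

  module ≈-Reasoning = SetoidReasoning ≈-setoid
  open ≈-Reasoning

  *-≈ : ∀ {a a′ b b′} → a ≈ a′ → b ≈ b′ → a * b ≈ a′ * b′
  *-≈ {a} {a′} {b} {b′} (mk≈ a≈a′) (mk≈ b≈b′) = mk≈
    (trans (%-distribˡ-* a b q) (trans (cong₂ (λ x y → x * y % q) a≈a′ b≈b′) (sym (%-distribˡ-* a′ b′ q))))

  +-≈ : ∀ {a a′ b b′} → a ≈ a′ → b ≈ b′ → a + b ≈ a′ + b′
  +-≈ {a} {a′} {b} {b′} (mk≈ a≈a′) (mk≈ b≈b′) = mk≈
    (trans (%-distribˡ-+ a b q) (trans (cong₂ (λ x y → (x + y) % q) a≈a′ b≈b′) (sym (%-distribˡ-+ a′ b′ q))))

  *-≈ˡ : ∀ c {a a′} → a ≈ a′ → c * a ≈ c * a′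
  *-≈ˡ c = *-≈ (≈-refl {c})

  *-≈ʳ : ∀ c {a a′} → a ≈ a′ → a * c ≈ a′ * c
  *-≈ʳ c a≈a′ = *-≈ a≈a′ (≈-refl {c})

  _≈?_ : ∀ a b → Dec (a ≈ b)
  a ≈? b = map′ mk≈ ≈⇒%≡ (a % q ≟ b % q)

  ^-≈ : ∀ {a a′} k → a ≈ a′ → a ^ k ≈ a′ ^ k
  ^-≈ zero    a≈a′ = ≈-refl
  ^-≈ (suc k) a≈a′ = *-≈ a≈a′ (^-≈ k a≈a′)

  %-≈ : ∀ a → a % q ≈ a
  %-≈ a = mk≈ (m%n%n≡m%n a q)

  ∣⇒≈0 : ∀ {a} → q ∣ a → a ≈ 0
  ∣⇒≈0 {a} q∣a = mk≈ (trans (n∣m⇒m%n≡0 a q q∣a) (sym (n∣m⇒m%n≡0 0 q (q ∣0))))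

  +-cancelˡ-≈ : ∀ a {b c} → a + b ≈ a + c → b ≈ c
  +-cancelˡ-≈ a {b} {c} a+b≈a+c = begin
    b             ≈⟨ +-≈ (≈-sym a⁻+a≈0) ≈-refl ⟩
    a⁻ + a + b    ≡⟨ +-assoc a⁻ a b ⟩
    a⁻ + (a + b)  ≈⟨ +-≈ {a⁻} ≈-refl a+b≈a+c ⟩
    a⁻ + (a + c)  ≡⟨ +-assoc a⁻ a c ⟨
    a⁻ + a + c    ≈⟨ +-≈ a⁻+a≈0 ≈-refl ⟩
    c             ∎
    where
    a⁻ = q ∸ a % q
    a⁻+a≈0 : a⁻ + a ≈ 0
    a⁻+a≈0 = begin
      a⁻ + a       ≈⟨ +-≈ {a⁻} ≈-refl (≈-sym (%-≈ a)) ⟩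
      a⁻ + a % q   ≡⟨ m∸n+n≡m (m%n≤n a q) ⟩
      q            ≈⟨ ∣⇒≈0 ∣-refl ⟩
      0            ∎

  Unit : ℕ → Set
  Unit x = Coprime x q

  unit-1 : Unit 1
  unit-1 = 1-coprimeTo q

  unit-* : ∀ {x y} → Unit x → Unit y → Unit (x * y)
  unit-* {x} {y} ux uy {i} (i∣xy , i∣q) = uy (coprime-divisor i⊥x i∣xy , i∣q)
    where
    i⊥x : Coprime i x
    i⊥x (j∣i , j∣x) = ux (j∣x , ∣-trans j∣i i∣q)

  unit-^ : ∀ {x} k → Unit x → Unit (x ^ k)
  unit-^ zero    ux = unit-1
  unit-^ (suc k) ux = unit-* ux (unit-^ k ux)

  unit-% : ∀ {x} → Unit x → Unit (x % q)
  unit-% {x} ux {d} (d∣x%q , d∣q) = ux (subst (d ∣_) (sym (m≡m%n+[m/n]*n x q)) d∣x , d∣q)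
    where
    d∣x = ∣m∣n⇒∣m+n d∣x%q (∣-trans d∣q (n∣m*n (x / q)))

  -- In the second Bézout case a x ≈ -1, so a x a is an inverse of x.
  inverse : ∀ {x} → Unit x → Σ ℕ λ y → x * y ≈ 1
  inverse {x} ux with coprime-Bézout ux
  ... | Bézout.+- a b eq = a , (begin
    x * a      ≡⟨ *-comm x a ⟩
    a * x      ≡⟨ eq ⟨
    1 + b * q  ≈⟨ +-≈ {1} ≈-refl (∣⇒≈0 (n∣m*n b)) ⟩
    1          ∎)
  ... | Bézout.-+ a b eq = a * x * a , +-cancelˡ-≈ (x * a) (begin
    x * a + x * (a * x * a)   ≡⟨ solve 2 (λ x a → x :* a :+ x :* (a :* x :* a) := (con 1 :+ a :* x) :* (a :* x)) refl x a ⟩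
    (1 + a * x) * (a * x)     ≡⟨ cong (_* (a * x)) eq ⟩
    b * q * (a * x)           ≈⟨ ∣⇒≈0 (∣-trans (n∣m*n b) (m∣m*n (a * x))) ⟩
    0                         ≈⟨ ∣⇒≈0 (n∣m*n b) ⟨
    b * q                     ≡⟨ eq ⟨
    1 + a * x                 ≡⟨ solve 2 (λ x a → con 1 :+ a :* x := x :* a :+ con 1) refl x a ⟩
    x * a + 1                 ∎)

  *-cancelˡ-≈ : ∀ {x u v} → Unit x → x * u ≈ x * v → u ≈ v
  *-cancelˡ-≈ {x} {u} {v} ux xu≈xv with inverse ux
  ... | y , xy≈1 = begin
    u              ≡⟨ *-identityˡ u ⟨
    1 * u          ≈⟨ *-≈ʳ u (≈-sym xy≈1) ⟩
    x * y * u      ≡⟨ solve 3 (λ x y u → x :* y :* u := y :* (x :* u)) refl x y u ⟩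
    y * (x * u)    ≈⟨ *-≈ˡ y xu≈xv ⟩
    y * (x * v)    ≡⟨ solve 3 (λ x y v → y :* (x :* v) := x :* y :* v) refl x y v ⟩
    x * y * v      ≈⟨ *-≈ʳ v xy≈1 ⟩
    1 * v          ≡⟨ *-identityˡ v ⟩
    v              ∎

  ^-*-≈1 : ∀ {x} d → x ^ d ≈ 1 → ∀ s → x ^ (d * s) ≈ 1
  ^-*-≈1 {x} d xᵈ≈1 s = begin
    x ^ (d * s)   ≡⟨ ^-*-assoc x d s ⟨
    (x ^ d) ^ s   ≈⟨ ^-≈ s xᵈ≈1 ⟩
    1 ^ s         ≡⟨ ^-zeroˡ s ⟩
    1             ∎

  ^-%-≈ : ∀ x d .{{_ : NonZero d}} → x ^ d ≈ 1 → ∀ e → x ^ (e % d) ≈ x ^ e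
  ^-%-≈ x d xᵈ≈1 e = begin
    x ^ (e % d)                     ≡⟨ *-identityʳ _ ⟨
    x ^ (e % d) * 1                 ≈⟨ *-≈ˡ (x ^ (e % d)) (subst (λ w → x ^ w ≈ 1) (*-comm d (e / d)) (^-*-≈1 d xᵈ≈1 (e / d))) ⟨
    x ^ (e % d) * x ^ (e / d * d)   ≡⟨ ^-distribˡ-+-* x (e % d) (e / d * d) ⟨
    x ^ (e % d + e / d * d)         ≡⟨ cong (x ^_) (m≡m%n+[m/n]*n e d) ⟨
    x ^ e                           ∎

  -- Two of the powers x⁰, …, x^q agree modulo q; cancelling gives a period at most q.
  period : ∀ {x} → Unit x → Σ ℕ λ e → 1 ≤ e × e ≤ q × x ^ e ≈ 1
  period {x} ux with Fin.pigeonhole (n<1+n q) (λ k → fromℕ< (m%n<n (x ^ toℕ k) q))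
  ... | i , j , i<j , xⁱ≡xʲ = toℕ j ∸ toℕ i , m<n⇒0<n∸m i<j ,
        ≤-trans (m∸n≤m (toℕ j) (toℕ i)) (≤-pred (Fin.toℕ<n j)) ,
        *-cancelˡ-≈ (unit-^ (toℕ i) ux) (begin
          x ^ toℕ i * x ^ (toℕ j ∸ toℕ i) ≡⟨ ^-distribˡ-+-* x (toℕ i) _ ⟨
          x ^ (toℕ i + (toℕ j ∸ toℕ i))   ≡⟨ cong (x ^_) (m+[n∸m]≡n (<⇒≤ i<j)) ⟩
          x ^ toℕ j                       ≈⟨ xⁱ≈xʲ ⟨
          x ^ toℕ i                       ≡⟨ *-identityʳ _ ⟨
          x ^ toℕ i * 1                   ∎)
    where
    xⁱ≈xʲ : x ^ toℕ i ≈ x ^ toℕ j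
    xⁱ≈xʲ = mk≈ (trans (sym (Fin.toℕ-fromℕ< (m%n<n (x ^ toℕ i) q)))
                       (trans (cong toℕ xⁱ≡xʲ) (Fin.toℕ-fromℕ< (m%n<n (x ^ toℕ j) q))))

  exponent : ℕ
  exponent = q !

  instance
    exponent-nonZero : NonZero exponent
    exponent-nonZero = q !≢0

  ^-∣-≈1 : ∀ {x d e} → d ∣ e → x ^ d ≈ 1 → x ^ e ≈ 1
  ^-∣-≈1 {x} {d} (divides s e≡sd) xᵈ≈1 =
    subst (λ w → x ^ w ≈ 1) (sym (trans e≡sd (*-comm s d))) (^-*-≈1 d xᵈ≈1 s)

  ∣-! : ∀ {e n} → 1 ≤ e → e ≤ n → e ∣ n !
  ∣-! {suc e} _ e≤n = ∣-trans (m∣m*n (e !)) (m≤n⇒m!∣n! e≤n)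

  unit^exponent≈1 : ∀ {x} → Unit x → x ^ exponent ≈ 1
  unit^exponent≈1 ux = let e , 1≤e , e≤q , xᵉ≈1 = period ux in ^-∣-≈1 (∣-! 1≤e e≤q) xᵉ≈1

  unit-*-^-pred : ∀ {x} → Unit x → x * x ^ pred exponent ≈ 1
  unit-*-^-pred {x} ux = subst (λ e → x ^ e ≈ 1) (sym (suc-pred exponent)) (unit^exponent≈1 ux)

  ord-∣ : ∀ {x o e} → IsOrd q x o → x ^ e ≈ 1 → o ∣ e
  ord-∣ {x} {o} {e} (1≤o , xᵒ≡1 , least) xᵉ≈1 = m%n≡0⇒n∣m e o e%o≡0
    where
    instance _ = >-nonZero 1≤o
    e%o≡0 : e % o ≡ 0
    e%o≡0 with e % o in e%o≡
    ... | zero  = refl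
    ... | suc ρ = ⊥-elim (<⇒≱ (subst (_< o) e%o≡ (m%n<n e o)) (least (suc ρ) (s≤s z≤n) (≈⇒%≡ xᵖ≈1)))
      where
      xᵖ≈1 : x ^ suc ρ ≈ 1
      xᵖ≈1 = subst (λ w → x ^ w ≈ 1) e%o≡ (≈-trans (^-%-≈ x o (mk≈ xᵒ≡1) e) xᵉ≈1)

module PrimePowers where

  open import Data.Nat
  open import Data.Nat.Properties
  open import Data.Nat.Divisibility
  open import Data.Nat.Primality
  open import Data.Nat.Primality.Factorisation using (PrimeFactorisation; factorise)
  open import Data.Nat.ListAction using (product)
  open import Data.Nat.Induction using (<-wellFounded)
  open import Data.List using ([]; _∷_)
  open import Data.List.Relation.Unary.All using (All; []; _∷_)
  open import Data.Product using (Σ; ∃₂; _×_; _,_)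
  open import Data.Sum using ([_,_]′)
  open import Data.Empty using (⊥-elim)
  open import Induction.WellFounded using (Acc; acc)
  open import Relation.Binary.PropositionalEquality
  open import Relation.Nullary using (¬_; yes; no)
  open import Data.Nat.Solver using (module +-*-Solver)
  open +-*-Solver

  -- v_p(o) ≤ v_p(r) at every prime p ∣ r.
  ExponentsBounded : ℕ → ℕ → Set
  ExponentsBounded r o = (p a : ℕ) → Prime p → 1 ≤ a → p ^ a ∣ r → ¬ (p ^ (a + 1) ∣ r) → ¬ (p ^ (a + 1) ∣ o)

  primePart : ∀ {p} → Prime p → ∀ n .{{_ : NonZero n}} → ∃₂ λ a n′ → n ≡ p ^ a * n′ × ¬ p ∣ n′
  primePart {p} pp n = go n (<-wellFounded n) (≢-nonZero⁻¹ n)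
    where
    go : ∀ n → Acc _<_ n → n ≢ 0 → ∃₂ λ a n′ → n ≡ p ^ a * n′ × ¬ p ∣ n′
    go n (acc rec) n≢0 with p ∣? n
    ... | no p∤n = 0 , n , sym (*-identityˡ n) , p∤n
    ... | yes (divides n₁ n≡n₁p) with go n₁ (rec n₁<n) n₁≢0
      where
      n₁≢0 : n₁ ≢ 0
      n₁≢0 n₁≡0 = n≢0 (trans n≡n₁p (cong (_* p) n₁≡0))
      n₁<n : n₁ < n
      n₁<n = subst (n₁ <_) (sym n≡n₁p) (m<m*n n₁ p {{≢-nonZero n₁≢0}} (nonTrivial⇒n>1 p {{prime⇒nonTrivial pp}}))
    ... | a , n′ , n₁≡pᵃn′ , p∤n′ = suc a , n′ , n≡pᵃ⁺¹n′ , p∤n′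
      where
      n≡pᵃ⁺¹n′ : n ≡ p ^ suc a * n′
      n≡pᵃ⁺¹n′ = trans n≡n₁p (trans (cong (_* p) n₁≡pᵃn′) (solve 3 (λ x y z → x :* y :* z := z :* x :* y) refl (p ^ a) n′ p))

  ^-∣-^ : ∀ p {i j} → i ≤ j → p ^ i ∣ p ^ j
  ^-∣-^ p {i} {j} i≤j = divides (p ^ (j ∸ i)) (trans (cong (p ^_) (sym (m∸n+n≡m i≤j))) (^-distribˡ-+-* p (j ∸ i) i))

  exactPower : ∀ {p r} .{{_ : NonZero r}} → Prime p → p ∣ r → Σ ℕ λ a → 1 ≤ a × p ^ a ∣ r × ¬ (p ^ (a + 1) ∣ r)
  exactPower {p} {r} pp p∣r with primePart pp r
  ... | zero  , r′ , r≡r′ , p∤r′ = ⊥-elim (p∤r′ (subst (p ∣_) (trans r≡r′ (*-identityˡ r′)) p∣r))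
  ... | suc a , r′ , r≡ , p∤r′ = suc a , s≤s z≤n , divides r′ (trans r≡ (*-comm _ r′)) , pᵃ⁺¹∤r
    where
    instance _ = m^n≢0 p (suc a) {{prime⇒nonZero pp}}
    pᵃ⁺¹∤r : ¬ (p ^ (suc a + 1) ∣ r)
    pᵃ⁺¹∤r pᵃ⁺¹∣r = p∤r′ (*-cancelˡ-∣ (p ^ suc a) (subst₂ _∣_ pᵃ⁺¹≡ r≡ pᵃ⁺¹∣r))
      where
      pᵃ⁺¹≡ : p ^ (suc a + 1) ≡ p ^ suc a * p
      pᵃ⁺¹≡ = trans (^-distribˡ-+-* p (suc a) 1) (cong (p ^ suc a *_) (*-identityʳ p))

  ¬^∣⇒≤ : ∀ p {a ω n} → ¬ (p ^ (a + 1) ∣ p ^ ω * n) → ω ≤ a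
  ¬^∣⇒≤ p {a} {ω} {n} pᵃ⁺¹∤ with ω ≤? a
  ... | yes ω≤a = ω≤a
  ... | no  ω≰a = ⊥-elim (pᵃ⁺¹∤ (∣-trans (^-∣-^ p (subst (_≤ ω) (+-comm 1 a) (≰⇒> ω≰a))) (m∣m*n n)))

  ^-*-cancel-∣ : ∀ p .{{_ : NonZero p}} {a ω m n} → ω ≤ a → p ^ a * m ∣ p ^ ω * n → m ∣ n
  ^-*-cancel-∣ p {a} {ω} {m} {n} ω≤a pᵃm∣pᵚn =
    ∣-trans (n∣m*n (p ^ (a ∸ ω))) (*-cancelˡ-∣ (p ^ ω) {{m^n≢0 p ω}} (subst (_∣ p ^ ω * n) pᵃm≡ pᵃm∣pᵚn))
    where
    pᵃm≡ : p ^ a * m ≡ p ^ ω * (p ^ (a ∸ ω) * m)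
    pᵃm≡ = begin
      p ^ a * m                 ≡⟨ cong (λ w → p ^ w * m) (m+[n∸m]≡n ω≤a) ⟨
      p ^ (ω + (a ∸ ω)) * m     ≡⟨ cong (_* m) (^-distribˡ-+-* p ω (a ∸ ω)) ⟩
      p ^ ω * p ^ (a ∸ ω) * m   ≡⟨ *-assoc (p ^ ω) _ m ⟩
      p ^ ω * (p ^ (a ∸ ω) * m) ∎
      where open ≡-Reasoning

  module _ {r o m K : ℕ} .{{_ : NonZero r}} .{{_ : NonZero o}}
           (bounded : ExponentsBounded r o) (rm∣Ko : r * m ∣ K * o) where

    -- As v_p(o) ≤ v_p(r), the p-part of o cancels against that of r in r m ∣ K o.
    ∣-strip-prime : ∀ {p ω o′} → Prime p → p ∣ r → o ≡ p ^ ω * o′ → m ∣ K * o′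
    ∣-strip-prime {p} {ω} {o′} pp p∣r o≡ =
      let a , 1≤a , pᵃ∣r , pᵃ⁺¹∤r = exactPower pp p∣r
          ω≤a = ¬^∣⇒≤ p {a} {ω} {o′} λ pᵃ⁺¹∣ →
                  bounded p a pp 1≤a pᵃ∣r pᵃ⁺¹∤r (subst (p ^ (a + 1) ∣_) (sym o≡) pᵃ⁺¹∣)
      in ^-*-cancel-∣ p {{prime⇒nonZero pp}} {a} {ω} ω≤a (begin
        p ^ a * m        ∣⟨ *-monoˡ-∣ m pᵃ∣r ⟩
        r * m            ∣⟨ rm∣Ko ⟩
        K * o            ≡⟨ cong (K *_) o≡ ⟩
        K * (p ^ ω * o′) ≡⟨ solve 3 (λ k u o → k :* (u :* o) := u :* (k :* o)) refl K (p ^ ω) o′ ⟩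
        p ^ ω * (K * o′) ∎)
      where open ∣-Reasoning

    common-divisor-∣ : ∀ {d} → d ∣ m → d ∣ r → d ∣ K
    common-divisor-∣ {d} d∣m d∣r =
      subst (_∣ K) (sym isFactorisation) (go factorsPrime (subst (_∣ m) isFactorisation d∣m) (subst (_∣ r) isFactorisation d∣r))
      where
      instance
        d≢0 : NonZero d
        d≢0 = ≢-nonZero λ d≡0 → ≢-nonZero⁻¹ r (0∣⇒≡0 (subst (_∣ r) d≡0 d∣r))
      open PrimeFactorisation (factorise d)

      prime-step : ∀ {p y} → Prime p → .{{_ : NonZero y}} → p * y ∣ m → p ∣ r → y ∣ K → p * y ∣ K
      prime-step {p} {y} pp py∣m p∣r (divides K₁ K≡K₁y) =
        let ω , o′ , o≡ , p∤o′ = primePart pp o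
            Ko′≡y[K₁o′] = trans (cong (_* o′) K≡K₁y) (solve 3 (λ k y o → k :* y :* o := y :* (k :* o)) refl K₁ y o′)
            y*p∣y*K₁o′ = subst₂ _∣_ (*-comm p y) Ko′≡y[K₁o′] (∣-trans py∣m (∣-strip-prime {p} {ω} {o′} pp p∣r o≡))
        in [ (λ p∣K₁ → subst (p * y ∣_) (sym K≡K₁y) (*-monoˡ-∣ y p∣K₁)) , (λ p∣o′ → ⊥-elim (p∤o′ p∣o′)) ]′
             (euclidsLemma K₁ o′ pp (*-cancelˡ-∣ y y*p∣y*K₁o′))

      go : ∀ {ps} → All Prime ps → product ps ∣ m → product ps ∣ r → product ps ∣ K
      go [] _ _ = 1∣ K
      go {p ∷ ps} (pp ∷ pps) pys∣m pys∣r =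
        prime-step pp {{productOfPrimes≢0 pps}} pys∣m (∣-trans (m∣m*n (product ps)) pys∣r)
          (go pps (∣-trans (n∣m*n p) pys∣m) (∣-trans (n∣m*n p) pys∣r))

module Search where

  open import Data.Nat
  open import Data.Nat.Properties using (≤-trans; anyUpTo?)
  open import Data.Product using (∃; _×_; _,_)
  open import Relation.Nullary using (¬_; yes; no)
  open import Relation.Unary using (Decidable)

  least : ∀ {P : ℕ → Set} → Decidable P → ∀ n → (∃ λ m → m < n × P m) → ∃ λ m → P m × (∀ {k} → k < m → ¬ P k)
  least P? zero    (_ , () , _)
  least P? (suc n) (m , s≤s m≤n , Pm) with anyUpTo? P? n
  ... | yes below = least P? n below
  ... | no  none  = m , Pm , λ k<m Pk → none (_ , ≤-trans k<m m≤n , Pk)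

module FunctionUpdate where

  open import Data.Nat using (_≟_)
  open import Data.Empty using (⊥-elim)
  open import Relation.Binary.PropositionalEquality
  open import Relation.Nullary using (yes; no)

  update : {A : Set} → (ℕ → A) → ℕ → A → ℕ → A
  update f n a i with i ≟ n
  ... | yes _ = a
  ... | no  _ = f i

  update-≡ : ∀ {A : Set} (f : ℕ → A) n a → update f n a n ≡ a
  update-≡ f n a with n ≟ n
  ... | yes _   = refl
  ... | no  n≢n = ⊥-elim (n≢n refl)

  update-≢ : ∀ {A : Set} (f : ℕ → A) n a {i} → i ≢ n → update f n a i ≡ f i
  update-≢ f n a {i} i≢n with i ≟ n
  ... | yes i≡n = ⊥-elim (i≢n i≡n)
  ... | no  _   = refl

module Extension (q : ℕ) .{{_ : NonZero q}} (g : ℕ → ℕ) (g-unit : ∀ i → Units.Unit q (g i)) where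

  open import Data.Nat
  open import Data.Nat.Properties
  open import Data.Nat.DivMod
  open import Data.Nat.Divisibility
  open import Data.Integer using (+_)
  open import Data.Rational as ℚ using (ℚ; 0ℚ; 1ℚ)
  import Data.Rational.Solver as ℚ-Solver
  import Data.Nat.Solver as ℕ-Solver
  open import Data.Product using (Σ; ∃; _×_; _,_)
  open import Data.Sum using ([_,_]′)
  open import Data.Empty using (⊥-elim)
  open import Relation.Binary.PropositionalEquality
  open import Relation.Nullary using (Dec; ¬_)
  open import Relation.Nullary.Decidable using (map′)
  open Units q
  open IntegerRationals
  open FunctionUpdate
  open Search

  word : ℕ → (ℕ → ℕ) → ℕ
  word zero    k = 1
  word (suc n) k = word n k * g n ^ k n

  angle : ℕ → (ℕ → ℚ) → (ℕ → ℕ) → ℚ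
  angle zero    t k = 0ℚ
  angle (suc n) t k = angle n t k ℚ.+ fromℕ (k n) ℚ.* t n

  Consistent : ℕ → (ℕ → ℚ) → Set
  Consistent n t = ∀ k → word n k ≈ 1 → IsInteger (angle n t k)

  consistent-0 : ∀ t → Consistent 0 t
  consistent-0 t k _ = + 0 , refl

  word-unit : ∀ n k → Unit (word n k)
  word-unit zero    k = unit-1
  word-unit (suc n) k = unit-* (word-unit n k) (unit-^ (k n) (g-unit n))

  word-cong : ∀ n {k k′} → (∀ {i} → i < n → k i ≡ k′ i) → word n k ≡ word n k′
  word-cong zero    eq = refl
  word-cong (suc n) eq = cong₂ (λ w e → w * g n ^ e) (word-cong n (λ i<n → eq (m<n⇒m<1+n i<n))) (eq (n<1+n n))

  angle-cong : ∀ n {t t′ k k′} → (∀ {i} → i < n → t i ≡ t′ i) → (∀ {i} → i < n → k i ≡ k′ i) →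
               angle n t k ≡ angle n t′ k′
  angle-cong zero    eqt eqk = refl
  angle-cong (suc n) eqt eqk = cong₂ ℚ._+_
    (angle-cong n (λ i<n → eqt (m<n⇒m<1+n i<n)) (λ i<n → eqk (m<n⇒m<1+n i<n)))
    (cong₂ (λ c τ → fromℕ c ℚ.* τ) (eqk (n<1+n n)) (eqt (n<1+n n)))

  word-0 : ∀ n → word n (λ _ → 0) ≡ 1
  word-0 zero    = refl
  word-0 (suc n) = cong (_* 1) (word-0 n)

  word-+ : ∀ n k k′ → word n (λ i → k i + k′ i) ≡ word n k * word n k′
  word-+ zero    k k′ = refl
  word-+ (suc n) k k′ = begin
    word n (λ i → k i + k′ i) * g n ^ (k n + k′ n)       ≡⟨ cong₂ _*_ (word-+ n k k′) (^-distribˡ-+-* (g n) (k n) (k′ n)) ⟩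
    word n k * word n k′ * (g n ^ k n * g n ^ k′ n)
      ≡⟨ solve 4 (λ a b c d → a :* b :* (c :* d) := a :* c :* (b :* d)) refl (word n k) (word n k′) (g n ^ k n) (g n ^ k′ n) ⟩
    word n k * g n ^ k n * (word n k′ * g n ^ k′ n)       ∎
    where
    open ≡-Reasoning
    open ℕ-Solver.+-*-Solver

  ^-distribʳ-* : ∀ a b c → (a * b) ^ c ≡ a ^ c * b ^ c
  ^-distribʳ-* a b zero    = refl
  ^-distribʳ-* a b (suc c) = begin
    a * b * (a * b) ^ c       ≡⟨ cong (a * b *_) (^-distribʳ-* a b c) ⟩
    a * b * (a ^ c * b ^ c)   ≡⟨ solve 4 (λ a b x y → a :* b :* (x :* y) := a :* x :* (b :* y)) refl a b (a ^ c) (b ^ c) ⟩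
    a * a ^ c * (b * b ^ c)   ∎
    where
    open ≡-Reasoning
    open ℕ-Solver.+-*-Solver

  word-* : ∀ n c k → word n (λ i → c * k i) ≡ word n k ^ c
  word-* zero    c k = sym (^-zeroˡ c)
  word-* (suc n) c k = begin
    word n (λ i → c * k i) * g n ^ (c * k n)
      ≡⟨ cong₂ _*_ (word-* n c k) (trans (cong (g n ^_) (*-comm c (k n))) (sym (^-*-assoc (g n) (k n) c))) ⟩
    word n k ^ c * (g n ^ k n) ^ c             ≡⟨ ^-distribʳ-* (word n k) (g n ^ k n) c ⟨
    (word n k * g n ^ k n) ^ c                 ∎
    where open ≡-Reasoning

  angle-+ : ∀ n t k k′ → angle n t (λ i → k i + k′ i) ≡ angle n t k ℚ.+ angle n t k′
  angle-+ zero    t k k′ = refl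
  angle-+ (suc n) t k k′ = begin
    angle n t (λ i → k i + k′ i) ℚ.+ fromℕ (k n + k′ n) ℚ.* t n
      ≡⟨ cong₂ (λ a c → a ℚ.+ c ℚ.* t n) (angle-+ n t k k′) (fromℕ-+ (k n) (k′ n)) ⟩
    angle n t k ℚ.+ angle n t k′ ℚ.+ (fromℕ (k n) ℚ.+ fromℕ (k′ n)) ℚ.* t n
      ≡⟨ solve 5 (λ a b c d e → a :+ b :+ (c :+ d) :* e := a :+ c :* e :+ (b :+ d :* e))
                 refl (angle n t k) (angle n t k′) (fromℕ (k n)) (fromℕ (k′ n)) (t n) ⟩
    angle n t k ℚ.+ fromℕ (k n) ℚ.* t n ℚ.+ (angle n t k′ ℚ.+ fromℕ (k′ n) ℚ.* t n) ∎
    where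
    open ≡-Reasoning
    open ℚ-Solver.+-*-Solver

  angle-* : ∀ n t c k → angle n t (λ i → c * k i) ≡ fromℕ c ℚ.* angle n t k
  angle-* zero    t c k = solve 1 (λ x → con 0ℚ := x :* con 0ℚ) refl (fromℕ c)
    where open ℚ-Solver.+-*-Solver
  angle-* (suc n) t c k = begin
    angle n t (λ i → c * k i) ℚ.+ fromℕ (c * k n) ℚ.* t n
      ≡⟨ cong₂ (λ a b → a ℚ.+ b ℚ.* t n) (angle-* n t c k) (fromℕ-* c (k n)) ⟩
    fromℕ c ℚ.* angle n t k ℚ.+ fromℕ c ℚ.* fromℕ (k n) ℚ.* t n
      ≡⟨ solve 4 (λ a b c d → a :* b :+ a :* c :* d := a :* (b :+ c :* d)) refl (fromℕ c) (angle n t k) (fromℕ (k n)) (t n) ⟩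
    fromℕ c ℚ.* (angle n t k ℚ.+ fromℕ (k n) ℚ.* t n) ∎
    where
    open ≡-Reasoning
    open ℚ-Solver.+-*-Solver

  angle-0 : ∀ n t → angle n t (λ _ → 0) ≡ 0ℚ
  angle-0 zero    t = refl
  angle-0 (suc n) t = trans (cong (ℚ._+ fromℕ 0 ℚ.* t n) (angle-0 n t)) (solve 1 (λ x → con 0ℚ :+ con 0ℚ :* x := con 0ℚ) refl (t n))
    where open ℚ-Solver.+-*-Solver

  word-inverse : ∀ n k → word n k * word n (λ i → pred exponent * k i) ≈ 1
  word-inverse n k = subst (λ w → word n k * w ≈ 1) (sym (word-* n (pred exponent) k)) (unit-*-^-pred (word-unit n k))

  -- k + (E - 1) k′ and E k′ are relations (E the universal exponent); their angles differ by
  -- angle k - angle k′.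
  consistent-≈ : ∀ {n t} → Consistent n t → ∀ k k′ → word n k ≈ word n k′ → IsInteger (angle n t k ℚ.- angle n t k′)
  consistent-≈ {n} {t} cons k k′ k≈k′ = subst IsInteger angles (isInteger-- (cons k₁ word₁≈1) (cons k₂ word₂≈1))
    where
    E′ = pred exponent
    k₁ = λ i → k i + E′ * k′ i
    k₂ = λ i → suc E′ * k′ i
    word₁≈1 : word n k₁ ≈ 1
    word₁≈1 = begin
      word n k₁                                ≡⟨ word-+ n k (λ i → E′ * k′ i) ⟩
      word n k * word n (λ i → E′ * k′ i)      ≈⟨ *-≈ʳ (word n (λ i → E′ * k′ i)) k≈k′ ⟩
      word n k′ * word n (λ i → E′ * k′ i)     ≈⟨ word-inverse n k′ ⟩
      1                                        ∎
      where open ≈-Reasoning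
    word₂≈1 : word n k₂ ≈ 1
    word₂≈1 = subst (_≈ 1) (sym (word-* n (suc E′) k′)) (unit-*-^-pred (word-unit n k′))
    angles : angle n t k₁ ℚ.- angle n t k₂ ≡ angle n t k ℚ.- angle n t k′
    angles = begin
      angle n t k₁ ℚ.- angle n t k₂
        ≡⟨ cong₂ ℚ._-_ (trans (angle-+ n t k _) (cong (angle n t k ℚ.+_) (angle-* n t E′ k′))) (angle-* n t (suc E′) k′) ⟩
      angle n t k ℚ.+ fromℕ E′ ℚ.* angle n t k′ ℚ.- fromℕ (1 + E′) ℚ.* angle n t k′
        ≡⟨ cong (λ c → angle n t k ℚ.+ fromℕ E′ ℚ.* angle n t k′ ℚ.- c ℚ.* angle n t k′) (fromℕ-+ 1 E′) ⟩
      angle n t k ℚ.+ fromℕ E′ ℚ.* angle n t k′ ℚ.- (1ℚ ℚ.+ fromℕ E′) ℚ.* angle n t k′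
        ≡⟨ solve 3 (λ a e b → a :+ e :* b :- (con 1ℚ :+ e) :* b := a :- b) refl (angle n t k) (fromℕ E′) (angle n t k′) ⟩
      angle n t k ℚ.- angle n t k′ ∎
      where
      open ≡-Reasoning
      open ℚ-Solver.+-*-Solver

  basis : ℕ → ℕ → ℕ
  basis j = update (λ _ → 0) j 1

  basis-below : ∀ {n j i} → n ≤ j → i < n → basis j i ≡ 0
  basis-below n≤j i<n = update-≢ (λ _ → 0) _ 1 (λ i≡j → <⇒≱ i<n (subst (_ ≤_) (sym i≡j) n≤j))

  word-basis : ∀ n j → j < n → word n (basis j) ≡ g j
  word-basis (suc n) j j<1+n = [ j<n , j≡n ]′ (m<1+n⇒m<n∨m≡n j<1+n)
    where
    j<n : j < n → word (suc n) (basis j) ≡ g j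
    j<n j<n = trans (cong₂ (λ w e → w * g n ^ e) (word-basis n j j<n) (update-≢ (λ _ → 0) j 1 (>⇒≢ j<n))) (*-identityʳ (g j))
    j≡n : j ≡ n → word (suc n) (basis j) ≡ g j
    j≡n refl = trans (cong₂ (λ w e → w * g j ^ e) (trans (word-cong j (basis-below ≤-refl)) (word-0 j)) (update-≡ (λ _ → 0) j 1))
                     (trans (*-identityˡ (g j ^ 1)) (*-identityʳ (g j)))

  angle-basis : ∀ n t j → j < n → angle n t (basis j) ≡ t j
  angle-basis (suc n) t j j<1+n = [ j<n , j≡n ]′ (m<1+n⇒m<n∨m≡n j<1+n)
    where
    open ℚ-Solver.+-*-Solver
    j<n : j < n → angle (suc n) t (basis j) ≡ t j
    j<n j<n = trans (cong₂ (λ a c → a ℚ.+ fromℕ c ℚ.* t n) (angle-basis n t j j<n) (update-≢ (λ _ → 0) j 1 (>⇒≢ j<n)))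
                    (solve 2 (λ x y → x :+ con 0ℚ :* y := x) refl (t j) (t n))
    j≡n : j ≡ n → angle (suc n) t (basis j) ≡ t j
    j≡n refl = trans (cong₂ (λ a c → a ℚ.+ fromℕ c ℚ.* t j) (trans (angle-cong j (λ _ → refl) (basis-below ≤-refl)) (angle-0 j t))
                                                          (update-≡ (λ _ → 0) j 1))
                     (solve 1 (λ x → con 0ℚ :+ con 1ℚ :* x := x) refl (t j))

  consistent-generators : ∀ {n t} → Consistent n t → ∀ {i j} → i < n → j < n → g i ≈ g j → IsInteger (t i ℚ.- t j)
  consistent-generators {n} {t} cons {i} {j} i<n j<n gᵢ≈gⱼ =
    subst IsInteger (cong₂ ℚ._-_ (angle-basis n t i i<n) (angle-basis n t j j<n))
      (consistent-≈ {n} {t} cons (basis i) (basis j) (subst₂ _≈_ (sym (word-basis n i i<n)) (sym (word-basis n j j<n)) gᵢ≈gⱼ))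

  consistent-generators-* : ∀ {n t} → Consistent n t → ∀ {i j l} → i < n → j < n → l < n → g l ≈ g i * g j →
                            IsInteger (t l ℚ.- (t i ℚ.+ t j))
  consistent-generators-* {n} {t} cons {i} {j} {l} i<n j<n l<n gₗ≈gᵢgⱼ =
    subst IsInteger (cong₂ ℚ._-_ (angle-basis n t l l<n)
                                 (trans (angle-+ n t (basis i) (basis j)) (cong₂ ℚ._+_ (angle-basis n t i i<n) (angle-basis n t j j<n))))
      (consistent-≈ {n} {t} cons (basis l) (λ x → basis i x + basis j x) words)
    where
    words : word n (basis l) ≈ word n (λ x → basis i x + basis j x)
    words = begin
      word n (basis l)                    ≡⟨ word-basis n l l<n ⟩
      g l                                 ≈⟨ gₗ≈gᵢgⱼ ⟩
      g i * g j                           ≡⟨ cong₂ _*_ (word-basis n i i<n) (word-basis n j j<n) ⟨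
      word n (basis i) * word n (basis j) ≡⟨ word-+ n (basis i) (basis j) ⟨
      word n (λ x → basis i x + basis j x) ∎
      where open ≈-Reasoning

  InCoset : ℕ → ℕ → ℕ → Set
  InCoset n y x = Σ (ℕ → ℕ) λ k → word n k * y ≈ x

  -- Exponents may be taken below the universal exponent, so the search is finite.
  inCoset? : ∀ n y x → Dec (InCoset n y x)
  inCoset? zero    y x = map′ (λ y≈x → (λ _ → 0) , ≈-trans (≈-reflexive (*-identityˡ y)) y≈x)
                              (λ (_ , 1y≈x) → ≈-trans (≈-reflexive (sym (*-identityˡ y))) 1y≈x) (y ≈? x)
  inCoset? (suc n) y x = map′ sound complete (anyUpTo? (λ j → inCoset? n (g n ^ j * y) x) exponent)
    where
    open ≈-Reasoning
    sound : (∃ λ j → j < exponent × InCoset n (g n ^ j * y) x) → InCoset (suc n) y x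
    sound (j , _ , k , e) = update k n j , (begin
      word n (update k n j) * g n ^ update k n j n * y
        ≡⟨ cong₂ (λ w e → w * g n ^ e * y) (word-cong n (λ i<n → update-≢ k n j (<⇒≢ i<n))) (update-≡ k n j) ⟩
      word n k * g n ^ j * y     ≡⟨ *-assoc (word n k) (g n ^ j) y ⟩
      word n k * (g n ^ j * y)   ≈⟨ e ⟩
      x                          ∎)
    complete : InCoset (suc n) y x → ∃ λ j → j < exponent × InCoset n (g n ^ j * y) x
    complete (k , e) = k n % exponent , m%n<n (k n) exponent , k , (begin
      word n k * (g n ^ (k n % exponent) * y)
        ≈⟨ *-≈ˡ (word n k) (*-≈ʳ y (^-%-≈ (g n) exponent (unit^exponent≈1 (g-unit n)) (k n))) ⟩
      word n k * (g n ^ k n * y) ≡⟨ *-assoc (word n k) (g n ^ k n) y ⟨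
      word n k * g n ^ k n * y   ≈⟨ e ⟩
      x                          ∎)

  record RelativeOrder (n : ℕ) : Set where
    field
      order      : ℕ
      order≢0    : NonZero order
      relation   : ℕ → ℕ
      relation-≈ : word n relation ≈ g n ^ order
      order-∣    : ∀ {y} k → word n k ≈ g n ^ y → order ∣ y

  gʸ≈g^[y%o]*word : ∀ n {o k} .{{_ : NonZero o}} → word n k ≈ g n ^ o →
            ∀ y → g n ^ y ≈ g n ^ (y % o) * word n (λ i → y / o * k i)
  gʸ≈g^[y%o]*word n {o} {k} wk≈gᵒ y = begin
    g n ^ y                             ≡⟨ cong (g n ^_) (m≡m%n+[m/n]*n y o) ⟩
    g n ^ (y % o + y / o * o)           ≡⟨ ^-distribˡ-+-* (g n) (y % o) (y / o * o) ⟩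
    g n ^ (y % o) * g n ^ (y / o * o)   ≡⟨ cong (λ e → g n ^ (y % o) * g n ^ e) (*-comm (y / o) o) ⟩
    g n ^ (y % o) * g n ^ (o * (y / o)) ≡⟨ cong (g n ^ (y % o) *_) (^-*-assoc (g n) o (y / o)) ⟨
    g n ^ (y % o) * (g n ^ o) ^ (y / o) ≈⟨ *-≈ˡ (g n ^ (y % o)) (^-≈ (y / o) (≈-sym wk≈gᵒ)) ⟩
    g n ^ (y % o) * word n k ^ (y / o)  ≡⟨ cong (g n ^ (y % o) *_) (word-* n (y / o) k) ⟨
    g n ^ (y % o) * word n (λ i → y / o * k i) ∎
    where open ≈-Reasoning

  -- A remainder y % o ≠ 0 would be a smaller power of g_n in the subgroup.
  minimal⇒order-∣ : ∀ n {m k} → word n k ≈ g n ^ suc m → (∀ {j} → j < m → ¬ InCoset n 1 (g n ^ suc j)) →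
                    ∀ {y} k′ → word n k′ ≈ g n ^ y → suc m ∣ y
  minimal⇒order-∣ n {m} {k} wk≈gᵒ minimal {y} k′ wk′≈gʸ = remainder (y % suc m) refl
    where
    open ≈-Reasoning
    ks = λ i → y / suc m * k i
    ks⁻ = λ i → pred exponent * ks i
    remainder : ∀ ρ → y % suc m ≡ ρ → suc m ∣ y
    remainder zero    y%o≡0 = m%n≡0⇒n∣m y (suc m) y%o≡0
    remainder (suc ρ) y%o≡ = ⊥-elim (minimal (≤-pred (subst (_< suc m) y%o≡ (m%n<n y (suc m))))
                                              ((λ i → k′ i + ks⁻ i) , smaller))
      where
      smaller : word n (λ i → k′ i + ks⁻ i) * 1 ≈ g n ^ suc ρ
      smaller = begin
        word n (λ i → k′ i + ks⁻ i) * 1           ≡⟨ trans (*-identityʳ _) (word-+ n k′ ks⁻) ⟩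
        word n k′ * word n ks⁻                    ≈⟨ *-≈ʳ (word n ks⁻) wk′≈gʸ ⟩
        g n ^ y * word n ks⁻                      ≈⟨ *-≈ʳ (word n ks⁻) (gʸ≈g^[y%o]*word n wk≈gᵒ y) ⟩
        g n ^ (y % suc m) * word n ks * word n ks⁻ ≡⟨ *-assoc (g n ^ (y % suc m)) (word n ks) (word n ks⁻) ⟩
        g n ^ (y % suc m) * (word n ks * word n ks⁻) ≈⟨ *-≈ˡ (g n ^ (y % suc m)) (word-inverse n ks) ⟩
        g n ^ (y % suc m) * 1                     ≡⟨ cong (λ e → g n ^ e * 1) y%o≡ ⟩
        g n ^ suc ρ * 1                           ≡⟨ *-identityʳ (g n ^ suc ρ) ⟩
        g n ^ suc ρ                               ∎

  relativeOrder : ∀ n → RelativeOrder n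
  relativeOrder n =
    let m , (k , wk≈gᵒ) , minimal = least (λ j → inCoset? n 1 (g n ^ suc j)) exponent
                                          (pred exponent , pred<exponent , (λ _ → 0) , gᴱ∈)
        wk≈gᵒ′ = ≈-trans (≈-reflexive (sym (*-identityʳ (word n k)))) wk≈gᵒ
    in record
      { order = suc m ; order≢0 = _ ; relation = k ; relation-≈ = wk≈gᵒ′
      ; order-∣ = minimal⇒order-∣ n wk≈gᵒ′ minimal }
    where
    pred<exponent : pred exponent < exponent
    pred<exponent = subst (pred exponent <_) (suc-pred exponent) (n<1+n (pred exponent))
    gᴱ∈ : word n (λ _ → 0) * 1 ≈ g n ^ suc (pred exponent)
    gᴱ∈ = ≈-trans (≈-reflexive (cong (_* 1) (word-0 n))) (≈-sym (unit-*-^-pred (g-unit n)))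

  relation⁻¹-≈ : ∀ n k {y} → word n k * g n ^ y ≈ 1 → word n (λ i → pred exponent * k i) ≈ g n ^ y
  relation⁻¹-≈ n k {y} wk*gʸ≈1 = begin
    word n k⁻                          ≡⟨ *-identityˡ (word n k⁻) ⟨
    1 * word n k⁻                      ≈⟨ *-≈ʳ (word n k⁻) wk*gʸ≈1 ⟨
    word n k * g n ^ y * word n k⁻     ≡⟨ solve 3 (λ a b c → a :* b :* c := b :* (a :* c)) refl (word n k) (g n ^ y) (word n k⁻) ⟩
    g n ^ y * (word n k * word n k⁻)   ≈⟨ *-≈ˡ (g n ^ y) (word-inverse n k) ⟩
    g n ^ y * 1                        ≡⟨ *-identityʳ (g n ^ y) ⟩
    g n ^ y                            ∎
    where
    open ≈-Reasoning
    open ℕ-Solver.+-*-Solver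
    k⁻ = λ i → pred exponent * k i

  -- Given k with ∏_{i ≤ n} g_i^{k_i} ≈ 1, g_n^{k_n} lies in the subgroup, so k_n = s·order and
  -- k + s·relation is a relation among g₀, …, g_{n-1}.
  extend : ∀ {n t} → Consistent n t → (ρ : RelativeOrder n) → ∀ τ →
           IsInteger (fromℕ (RelativeOrder.order ρ) ℚ.* τ ℚ.- angle n t (RelativeOrder.relation ρ)) →
           Consistent (suc n) (update t n τ)
  extend {n} {t} cons ρ τ τ-integral k wk≈1 =
    subst IsInteger angles (isInteger-+ relation-integral (isInteger-* (isInteger-fromℤ (+ s)) τ-integral))
    where
    open RelativeOrder ρ
    y = k n
    o∣y = order-∣ {y} _ (relation⁻¹-≈ n k {y} wk≈1)
    s = quotient o∣y
    k₂ = λ i → k i + s * relation i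
    wk₂≈1 : word n k₂ ≈ 1
    wk₂≈1 = begin
      word n k₂                          ≡⟨ trans (word-+ n k _) (cong (word n k *_) (word-* n s relation)) ⟩
      word n k * word n relation ^ s     ≈⟨ *-≈ˡ (word n k) (^-≈ s relation-≈) ⟩
      word n k * (g n ^ order) ^ s
        ≡⟨ cong (word n k *_) (trans (^-*-assoc (g n) order s) (cong (g n ^_) (trans (*-comm order s) (sym (_∣_.equality o∣y))))) ⟩
      word n k * g n ^ y                 ≈⟨ wk≈1 ⟩
      1                                  ∎
      where open ≈-Reasoning
    relation-integral : IsInteger (angle n t k ℚ.+ fromℕ s ℚ.* angle n t relation)
    relation-integral = subst IsInteger (trans (angle-+ n t k _) (cong (angle n t k ℚ.+_) (angle-* n t s relation))) (cons k₂ wk₂≈1)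
    angles : angle n t k ℚ.+ fromℕ s ℚ.* angle n t relation ℚ.+ fromℤ (+ s) ℚ.* (fromℕ order ℚ.* τ ℚ.- angle n t relation)
           ≡ angle (suc n) (update t n τ) k
    angles = begin
      angle n t k ℚ.+ fromℕ s ℚ.* angle n t relation ℚ.+ fromℕ s ℚ.* (fromℕ order ℚ.* τ ℚ.- angle n t relation)
        ≡⟨ solve 5 (λ a b c d x → a :+ b :* x :+ b :* (c :* d :- x) := a :+ b :* c :* d)
                   refl (angle n t k) (fromℕ s) (fromℕ order) τ (angle n t relation) ⟩
      angle n t k ℚ.+ fromℕ s ℚ.* fromℕ order ℚ.* τ
        ≡⟨ cong₂ (λ a c → a ℚ.+ c ℚ.* τ) (angle-cong n (λ i<n → sym (update-≢ t n τ (<⇒≢ i<n))) (λ _ → refl))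
                                         (trans (sym (fromℕ-* s order)) (cong fromℕ (sym (_∣_.equality o∣y)))) ⟩
      angle n (update t n τ) k ℚ.+ fromℕ y ℚ.* τ
        ≡⟨ cong (λ τ′ → angle n (update t n τ) k ℚ.+ fromℕ y ℚ.* τ′) (update-≡ t n τ) ⟨
      angle (suc n) (update t n τ) k ∎
      where
      open ≡-Reasoning
      open ℚ-Solver.+-*-Solver

  -- Each further generator receives the angle angle(relation)/order.
  extendConsistent : ∀ d {n t} → Consistent n t → Σ (ℕ → ℚ) λ T → Consistent (d + n) T × (∀ {i} → i < n → T i ≡ t i)
  extendConsistent zero    {n} {t} cons = t , cons , λ _ → refl
  extendConsistent (suc d) {n} {t} cons =
    let T , consT , T≡t = extendConsistent d cons
        ρ = relativeOrder (d + n)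
        open RelativeOrder ρ
        instance _ = order≢0
        τ = angle (d + n) T relation ℚ.* (+ 1 ℚ./ order)
        τ-integral = subst IsInteger (sym (τ-solves {order} (angle (d + n) T relation))) (isInteger-fromℤ (+ 0))
    in update T (d + n) τ , extend consT ρ τ τ-integral ,
       λ {i} i<n → trans (update-≢ T (d + n) τ (<⇒≢ (≤-trans i<n (m≤n+m n d)))) (T≡t i<n)
    where
    τ-solves : ∀ {o} .{{_ : NonZero o}} a → fromℕ o ℚ.* (a ℚ.* (+ 1 ℚ./ o)) ℚ.- a ≡ 0ℚ
    τ-solves {o} a = begin
      fromℕ o ℚ.* (a ℚ.* (+ 1 ℚ./ o)) ℚ.- a
        ≡⟨ solve 3 (λ x a y → x :* (a :* y) :- a := a :* (x :* y) :- a) refl (fromℕ o) a (+ 1 ℚ./ o) ⟩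
      a ℚ.* (fromℕ o ℚ.* (+ 1 ℚ./ o)) ℚ.- a ≡⟨ cong (λ z → a ℚ.* z ℚ.- a) (fromℕ*1/n≡1 o) ⟩
      a ℚ.* 1ℚ ℚ.- a                        ≡⟨ solve 1 (λ a → a :* con 1ℚ :- a := con 0ℚ) refl a ⟩
      0ℚ                                    ∎
      where
      open ≡-Reasoning
      open ℚ-Solver.+-*-Solver

module Construction (q : ℕ) .{{_ : NonZero q}} (b c : ℕ) (b-unit : Coprime b q) (c-unit : Coprime c q)
                    (r : ℕ) .{{_ : NonZero r}} {ob oc : ℕ} (b-ord : IsOrd q b ob) (c-ord : IsOrd q c oc)
                    (r∣ob : r ∣ ob) (bounded : PrimePowers.ExponentsBounded r oc) where

  open import Data.Nat
  open import Data.Nat.Properties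
  open import Data.Nat.DivMod
  open import Data.Nat.Divisibility
  open import Data.Nat.Coprimality using (coprime?)
  open import Data.Nat.GCD using (gcd; gcd[m,n]∣m; gcd[m,n]∣n)
  open import Data.Integer using (+_)
  open import Data.Rational as ℚ using (ℚ; 0ℚ)
  open import Data.Rational.Properties using (+-inverseʳ)
  import Data.Rational.Solver as ℚ-Solver
  open import Data.Product using (Σ; _×_; _,_; proj₁; proj₂)
  open import Relation.Binary.PropositionalEquality
  open import Relation.Nullary using (yes; no)
  open import Data.Empty using (⊥-elim)
  open Units q
  open IntegerRationals
  open PrimePowers
  open FunctionUpdate

  unitOr1 : ℕ → ℕ
  unitOr1 i with coprime? i q
  ... | yes _ = i
  ... | no  _ = 1

  unitOr1-unit : ∀ i → Unit (unitOr1 i)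
  unitOr1-unit i with coprime? i q
  ... | yes i-unit = i-unit
  ... | no  _      = unit-1

  unitOr1-≡ : ∀ {i} → Unit i → unitOr1 i ≡ i
  unitOr1-≡ {i} i-unit with coprime? i q
  ... | yes _      = refl
  ... | no  ¬unit = ⊥-elim (¬unit i-unit)

  -- Index 2 + i carries the residue i, or the placeholder 1 when i is not a unit.
  generator : ℕ → ℕ
  generator zero          = b
  generator (suc zero)    = c
  generator (suc (suc i)) = unitOr1 i

  generator-unit : ∀ i → Unit (generator i)
  generator-unit zero          = b-unit
  generator-unit (suc zero)    = c-unit
  generator-unit (suc (suc i)) = unitOr1-unit i

  open Extension q generator generator-unit

  module ρb = RelativeOrder (relativeOrder 0)
  module ρc = RelativeOrder (relativeOrder 1)

  1/r : ℚ
  1/r = + 1 ℚ./ r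

  t₁ : ℕ → ℚ
  t₁ = update (λ _ → 0ℚ) 0 1/r

  consistent₁ : Consistent 1 t₁
  consistent₁ = extend {t = λ _ → 0ℚ} (consistent-0 (λ _ → 0ℚ)) (relativeOrder 0) 1/r
    (subst IsInteger (solve 1 (λ x → x := x :- con 0ℚ) refl (fromℕ ρb.order ℚ.* 1/r)) (∣⇒isInteger r r∣order))
    where
    open ℚ-Solver.+-*-Solver
    r∣order : r ∣ ρb.order
    r∣order = ∣-trans r∣ob (ord-∣ {e = ρb.order} b-ord (≈-sym ρb.relation-≈))

  K : ℕ
  K = ρc.relation 0

  gcd∣K : gcd ρc.order r ∣ K
  gcd∣K = common-divisor-∣ bounded r*order∣K*oc (gcd[m,n]∣m ρc.order r) (gcd[m,n]∣n ρc.order r)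
    where
    instance
      oc≢0 : NonZero oc
      oc≢0 = >-nonZero (proj₁ c-ord)
    order∣oc : ρc.order ∣ oc
    order∣oc = ρc.order-∣ {oc} (λ _ → 0) (≈-sym (mk≈ (proj₁ (proj₂ c-ord))))
    o₁ = quotient order∣oc
    bᴷᵒ¹≈1 : b ^ (K * o₁) ≈ 1
    bᴷᵒ¹≈1 = begin
      b ^ (K * o₁)            ≡⟨ ^-*-assoc b K o₁ ⟨
      (b ^ K) ^ o₁            ≡⟨ cong (_^ o₁) (*-identityˡ (b ^ K)) ⟨
      (1 * b ^ K) ^ o₁        ≈⟨ ^-≈ o₁ ρc.relation-≈ ⟩
      (c ^ ρc.order) ^ o₁
        ≡⟨ trans (^-*-assoc c ρc.order o₁) (cong (c ^_) (trans (*-comm ρc.order o₁) (sym (_∣_.equality order∣oc)))) ⟩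
      c ^ oc                  ≈⟨ mk≈ (proj₁ (proj₂ c-ord)) ⟩
      1                       ∎
      where open ≈-Reasoning
    r*order∣K*oc : r * ρc.order ∣ K * oc
    r*order∣K*oc = subst (r * ρc.order ∣_) (trans (*-assoc K o₁ ρc.order) (cong (K *_) (sym (_∣_.equality order∣oc))))
                         (*-monoˡ-∣ ρc.order (∣-trans r∣ob (ord-∣ {e = K * o₁} b-ord bᴷᵒ¹≈1)))

  τc : ℚ
  τc = proj₁ (solve-mod-1 ρc.order r K gcd∣K)

  t₂ : ℕ → ℚ
  t₂ = update t₁ 1 τc

  consistent₂ : Consistent 2 t₂
  consistent₂ = extend {t = t₁} consistent₁ (relativeOrder 1) τc
    (subst IsInteger (cong (λ a → fromℕ ρc.order ℚ.* τc ℚ.- a) K/r≡0+K/r) (proj₁ (proj₂ (solve-mod-1 ρc.order r K gcd∣K))))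
    where
    open ℚ-Solver.+-*-Solver
    K/r≡0+K/r : fromℕ K ℚ.* 1/r ≡ 0ℚ ℚ.+ fromℕ K ℚ.* 1/r
    K/r≡0+K/r = solve 1 (λ x → x := con 0ℚ :+ x) refl (fromℕ K ℚ.* 1/r)

  extended : Σ (ℕ → ℚ) λ T → Consistent (q + 2) T × (∀ {i} → i < 2 → T i ≡ t₂ i)
  extended = extendConsistent q {t = t₂} consistent₂

  T : ℕ → ℚ
  T = proj₁ extended

  T-consistent : Consistent (q + 2) T
  T-consistent = proj₁ (proj₂ extended)

  θ : ℕ → ℚ
  θ n = T (2 + n % q)

  index< : ∀ x → 2 + x % q < q + 2
  index< x = subst (2 + x % q <_) (+-comm 2 q) (+-monoʳ-< 2 (m%n<n x q))

  <2⇒<q+2 : ∀ {i} → i < 2 → i < q + 2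
  <2⇒<q+2 i<2 = <-≤-trans i<2 (m≤n+m 2 q)

  generator-index : ∀ {x} → Unit x → generator (2 + x % q) ≈ x
  generator-index {x} x-unit = ≈-trans (≈-reflexive (unitOr1-≡ (unit-% x-unit))) (%-≈ x)

  θ-mod : ∀ m n → Coprime m q → ModEq q m n → θ m ≡₁ θ n
  θ-mod m n _ m≡n = subst (λ w → IsInteger (T (2 + w) ℚ.- θ n)) (sym m≡n) (+ 0 , +-inverseʳ (θ n))

  θ-mul : ∀ m n → Coprime m q → Coprime n q → θ (m * n) ≡₁ θ m ℚ.+ θ n
  θ-mul m n m-unit n-unit = consistent-generators-* {t = T} T-consistent (index< m) (index< n) (index< (m * n)) (begin
    generator (2 + m * n % q)                   ≈⟨ generator-index (unit-* m-unit n-unit) ⟩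
    m * n                                       ≈⟨ *-≈ (generator-index m-unit) (generator-index n-unit) ⟨
    generator (2 + m % q) * generator (2 + n % q) ∎)
    where open ≈-Reasoning

  χ : DirChar q
  χ = record { θ = θ ; θ-mod = θ-mod ; θ-mul = θ-mul }

  θ-b : θ b ≡₁ 1/r
  θ-b = subst (λ w → IsInteger (θ b ℚ.- w)) (proj₂ (proj₂ extended) (s≤s z≤n))
          (consistent-generators {t = T} T-consistent (index< b) (<2⇒<q+2 (s≤s z≤n)) (generator-index b-unit))

  θ-c : fromℕ r ℚ.* θ c ≡₁ 0ℚ
  θ-c = subst IsInteger (solve 3 (λ r x y → r :* (x :- y) :+ r :* y := r :* x :- con 0ℚ) refl (fromℕ r) (θ c) τc)
          (isInteger-+ (isInteger-* (isInteger-fromℤ (+ r)) θc-τc) (proj₂ (proj₂ (solve-mod-1 ρc.order r K gcd∣K))))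
    where
    open ℚ-Solver.+-*-Solver
    θc-τc : IsInteger (θ c ℚ.- τc)
    θc-τc = subst (λ w → IsInteger (θ c ℚ.- w)) (proj₂ (proj₂ extended) (s≤s (s≤s z≤n)))
              (consistent-generators {t = T} T-consistent (index< c) (<2⇒<q+2 (s≤s (s≤s z≤n))) (generator-index c-unit))

open import Data.Nat using (_+_; _^_; _≤_)
open import Data.Nat.DivMod using (_%_)
open import Data.Nat.Primality using (Prime)
open import Data.Integer using (+_)
open import Data.Rational using (ℚ; _/_; _*_; 0ℚ)
open import Data.Product using (Σ; _×_; _,_)
open import Relation.Binary.PropositionalEquality using (_≢_)
open import Relation.Nullary using (¬_)

lemma3p3 : (q : ℕ) .{{_ : NonZero q}} → 3 ≤ q →
  (b c : ℕ) → b % q ≢ c % q → Coprime b q → Coprime c q →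
  (r : ℕ) .{{_ : NonZero r}} →
  (ob oc : ℕ) → IsOrd q b ob → IsOrd q c oc →
  r ∣ ob →
  ((p a : ℕ) → Prime p → 1 ≤ a → p ^ a ∣ r → ¬ (p ^ (a + 1) ∣ r) →
    ¬ (p ^ (a + 1) ∣ oc)) →
  Σ (DirChar q) (λ χ →
    (DirChar.θ χ b ≡₁ (+ 1 / r)) × ((+ r / 1) * DirChar.θ χ c ≡₁ 0ℚ))
lemma3p3 q _ b c _ b-unit c-unit r ob oc b-ord c-ord r∣ob bounded = χ , θ-b , θ-c
  where open Construction q b c b-unit c-unit r b-ord c-ord r∣ob bounded
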